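{- Let $H$ be a $4$-vertex $4$-color-critical multigraph with $h$ edges on vertices $x_1,x_2,x_3,x_4$ labeled so that $w_H(x_1x_2)=1$, and write $h_1=w_H(x_1x_3)$, $h_2=w_H(x_2x_3)$, $h_3=w_H(x_1x_4)$, $h_4=w_H(x_2x_4)$, $h_5=w_H(x_3x_4)$. Let $k\ge h$ and let $G_0$ be a simply $k$-colored multigraph on vertices $v_1,v_2,v_3,v_4$ with $a=w(v_1v_2)$, $b_1=w(v_1v_3)$, $b_2=w(v_2v_3)$, $c_1=w(v_1v_4)$, $c_2=w(v_2v_4)$, $c_3=w(v_3v_4)$, satisfying \[ a\ge h;\quad b_1\ge\tfrac{h-1}2,\ b_2\ge h-1;\quad c_1+c_2+c_3\ge\max\{3h-3,2k\},\ \min_i c_i\ge1,\ \mathrm{min}^{(2)}\{c_1,c_2,c_3\}\ge\tfrac{3h-3}4,\ \max_i c_i\ge h-1, \] where $\mathrm{min}^{(2)}$ denotes the second smallest value (with multiplicity). Then, unless $h_5\ge b_1$, $G_0$ contains a multicolored copy of $H$.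
   Context: Multigraphs are loopless; $w(uv)$ is the multiplicity of the pair $uv$. A simply $k$-colored multigraph is one whose edge multiset is decomposed into $k$ simple graphs (colors). $G_0$ contains a multicolored copy of $H$ if there is an injection $\phi:V(H)\to V(G_0)$ and, for each pair $xy$, $w_H(xy)$ edges between $\phi(x),\phi(y)$, all chosen edges having pairwise distinct colors. A multigraph is $4$-color-critical if it has chromatic number $4$ and has an edge whose removal (reducing multiplicity by one) lowers the chromatic number to $3$. -}

module Defs where

open import Data.Nat using (ℕ; zero; suc; _+_; _*_; _∸_; _≤_; _<_; _⊔_; _⊓_)
open import Data.Fin using (Fin) renaming (_<_ to _<ᶠ_)
open import Data.Fin.Properties using (_≟_)
open import Data.Bool using (Bool; true; false; if_then_else_; _∧_; _∨_)
open import Data.Product using (Σ; ∃; _×_; _,_)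
open import Relation.Nullary using (¬_; ⌊_⌋)
open import Relation.Binary.PropositionalEquality using (_≡_; _≢_)
open import Function.Definitions using (Injective)

-- Vertices of 4-vertex multigraphs: Fin 4 (index 0,1,2,3 = x₁..x₄ resp. v₁..v₄).
V : Set
V = Fin 4

vtx1 vtx2 vtx3 vtx4 : V
vtx1 = Fin.zero
vtx2 = Fin.suc Fin.zero
vtx3 = Fin.suc (Fin.suc Fin.zero)
vtx4 = Fin.suc (Fin.suc (Fin.suc Fin.zero))

Mult : Set
Mult = V → V → ℕ

IsLoopless : Mult → Set
IsLoopless w = (∀ x → w x x ≡ 0) × (∀ x y → w x y ≡ w y x)

edgeCount : Mult → ℕ
edgeCount w = w vtx1 vtx2 + w vtx1 vtx3 + w vtx1 vtx4 + w vtx2 vtx3 + w vtx2 vtx4 + w vtx3 vtx4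

Colorable : ℕ → Mult → Set
Colorable n w = Σ (V → Fin n) λ f → ∀ x y → 0 < w x y → f x ≢ f y

ChromaticNumber : Mult → ℕ → Set
ChromaticNumber w n = Colorable n w × ¬ Colorable (n ∸ 1) w

removeEdge : V → V → Mult → Mult
removeEdge x y w u v =
  if (⌊ u ≟ x ⌋ ∧ ⌊ v ≟ y ⌋) ∨ (⌊ u ≟ y ⌋ ∧ ⌊ v ≟ x ⌋) then w u v ∸ 1 else w u v

FourColorCritical : Mult → Set
FourColorCritical w =
  ChromaticNumber w 4 × (Σ V λ x → Σ V λ y → (1 ≤ w x y) × ChromaticNumber (removeEdge x y w) 3)

-- A simply k-colored multigraph on V: for each color c a simple graph E c
-- (symmetric, loopless); the multigraph is the edge-disjoint union of these.
SimplyColored : ℕ → Set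
SimplyColored k = Fin k → V → V → Bool

IsSimplyColored : ∀ {k} → SimplyColored k → Set
IsSimplyColored E = (∀ c x → E c x x ≡ false) × (∀ c x y → E c x y ≡ E c y x)

countTrue : ∀ k → (Fin k → Bool) → ℕ
countTrue zero    f = 0
countTrue (suc k) f = (if f Fin.zero then 1 else 0) + countTrue k (λ i → f (Fin.suc i))

mult : ∀ {k} → SimplyColored k → Mult
mult {k} E u v = countTrue k (λ c → E c u v)

-- edge slots of H: the w_H(xy) edges of each unordered pair x<y
Slot : Mult → Set
Slot w = Σ V λ x → Σ V λ y → (x <ᶠ y) × Fin (w x y)

slotFst : ∀ {w} → Slot w → V
slotFst (x , _) = x

slotSnd : ∀ {w} → Slot w → V
slotSnd (_ , y , _) = y

MulticoloredCopy : ∀ {k} → SimplyColored k → Mult → Set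
MulticoloredCopy {k} E w =
  Σ (V → V) λ φ → Injective _≡_ _≡_ φ ×
  Σ (Slot w → Fin k) λ col → Injective _≡_ _≡_ col ×
    (∀ s → E (col s) (φ (slotFst s)) (φ (slotSnd s)) ≡ true)

-- maximum, minimum and second smallest (median) of three numbers
max3 min3 mid3 : ℕ → ℕ → ℕ → ℕ
max3 a b c = a ⊔ b ⊔ c
min3 a b c = a ⊓ b ⊓ c
mid3 a b c = (a ⊓ b) ⊔ ((a ⊔ b) ⊓ c)

module Submission where

-- H is 4-critical on four vertices, so each of its six pairs carries an edge and h ≥ 6.  The single edge x₁x₂ goes to the sparsest pair at v₄,
-- and the weakly bounded pairs (v₁v₃ and the middle pair at v₄) are used early.  If the sparsest pair
-- at v₄ is not v₂v₄, v₁v₃ receives an edge of the lighter of two complementary halves of the edges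
-- between {x₁,x₂} and {x₃,x₄}.  Otherwise x₃x₄ goes to v₁v₃ (this is where h₅ < b₁ is used), followed
-- by a lightest pair between {x₁,x₂} and {x₃,x₄} on the middle pair at v₄; if that does not fit, then
-- h₅ ≥ (2h − 2)/3, and an order ending with x₃x₄ on v₁v₂ works instead.

open import Defs
open import Data.Nat using (ℕ; zero; suc; _+_; _*_; _∸_; _≤_; _<_; _≤ᵇ_; _⊔_; _⊓_; z≤n; s≤s; s≤s⁻¹; NonZero)
open import Data.Nat.Properties
open import Data.Nat.ListAction using (sum)
open import Data.Nat.ListAction.Properties using (sum-↭)
open import Data.Nat.Tactic.RingSolver using (solve-∀; solve)
open import Data.Fin using (Fin; toℕ; punchOut) renaming (_<_ to _<ᶠ_)
import Data.Fin as F
import Data.Fin.Properties as FP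
open import Data.Bool using (Bool; true; false; if_then_else_)
open import Data.Bool.Properties using () renaming (_≟_ to _≟ᵇ_)
open import Data.Product using (Σ; ∃; _×_; _,_; proj₁; proj₂)
import Data.Product.Properties as Σ
open import Data.Sum using (_⊎_; inj₁; inj₂)
open import Data.Unit using (⊤; tt)
open import Data.List using (List; []; _∷_; _++_; length; map; concatMap; allFin)
import Data.List.Properties as List
open import Data.List.Relation.Unary.Any using (here; there; any?)
open import Data.List.Membership.Propositional using (_∈_; _∉_)
open import Data.List.Membership.Propositional.Properties using (∈-allFin; ∈-map⁺; ∈-concat⁺′)
open import Data.List.Relation.Binary.Permutation.Propositional using (↭-sym)
open import Data.List.Relation.Binary.Permutation.Propositional.Properties using (∈-resp-↭; map⁺)
open import Data.List.Sort.InsertionSort (FP.≤-decTotalOrder 6) using (sort)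
open import Data.List.Sort.InsertionSort.Properties (FP.≤-decTotalOrder 6) using (sort-↭)
open import Relation.Nullary using (¬_; Dec; yes; no; contradiction; ¬?; _×-dec_)
open import Relation.Nullary.Decidable using (decidable-stable; True; toWitness; _→-dec_)
open import Relation.Binary.PropositionalEquality
open import Relation.Binary.Definitions using (DecidableEquality)
open import Function using (_∘_; id)
open import Function.Definitions using (Injective)

-- Encoded as Fin 6, numbered in the order of edgeCount, so that lists of pairs can be sorted.
Pair : Set
Pair = Fin 6

pattern p₁₂ = F.zero
pattern p₁₃ = F.suc F.zero
pattern p₁₄ = F.suc (F.suc F.zero)
pattern p₂₃ = F.suc (F.suc (F.suc F.zero))
pattern p₂₄ = F.suc (F.suc (F.suc (F.suc F.zero)))
pattern p₃₄ = F.suc (F.suc (F.suc (F.suc (F.suc F.zero))))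

lower upper : Pair → V
lower p₁₂ = vtx1
lower p₁₃ = vtx1
lower p₁₄ = vtx1
lower p₂₃ = vtx2
lower p₂₄ = vtx2
lower p₃₄ = vtx3
upper p₁₂ = vtx2
upper p₁₃ = vtx3
upper p₁₄ = vtx4
upper p₂₃ = vtx3
upper p₂₄ = vtx4
upper p₃₄ = vtx4

lower<upper : ∀ P → lower P <ᶠ upper P
lower<upper p₁₂ = s≤s z≤n
lower<upper p₁₃ = s≤s z≤n
lower<upper p₁₄ = s≤s z≤n
lower<upper p₂₃ = s≤s (s≤s z≤n)
lower<upper p₂₄ = s≤s (s≤s z≤n)
lower<upper p₃₄ = s≤s (s≤s (s≤s z≤n))

pairOf : ∀ {x y : V} → x <ᶠ y → Σ Pair λ P → lower P ≡ x × upper P ≡ y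
pairOf {_}                       {F.zero}                         ()
pairOf {F.zero}                  {F.suc F.zero}                   _ = p₁₂ , refl , refl
pairOf {F.suc _}                 {F.suc F.zero}                   (s≤s ())
pairOf {F.zero}                  {F.suc (F.suc F.zero)}           _ = p₁₃ , refl , refl
pairOf {F.suc F.zero}            {F.suc (F.suc F.zero)}           _ = p₂₃ , refl , refl
pairOf {F.suc (F.suc _)}         {F.suc (F.suc F.zero)}           (s≤s (s≤s ()))
pairOf {F.zero}                  {F.suc (F.suc (F.suc F.zero))}   _ = p₁₄ , refl , refl
pairOf {F.suc F.zero}            {F.suc (F.suc (F.suc F.zero))}   _ = p₂₄ , refl , refl
pairOf {F.suc (F.suc F.zero)}    {F.suc (F.suc (F.suc F.zero))}   _ = p₃₄ , refl , refl
pairOf {F.suc (F.suc (F.suc _))} {F.suc (F.suc (F.suc F.zero))}   (s≤s (s≤s (s≤s ())))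

sum-six : ∀ a b c d e f → a + (b + (c + (d + (e + (f + 0))))) ≡ a + b + c + d + e + f
sum-six = solve-∀

weight : Mult → Pair → ℕ
weight w P = w (lower P) (upper P)

sum-weights≡edgeCount : ∀ w → sum (map (weight w) (allFin 6)) ≡ edgeCount w
sum-weights≡edgeCount w = sum-six (w vtx1 vtx2) (w vtx1 vtx3) (w vtx1 vtx4) (w vtx2 vtx3) (w vtx2 vtx4) (w vtx3 vtx4)

-- Give y the colour of x and number the other vertices apart by punching y out.
module _ {x y : V} (y≢x : y ≢ x) where

  identify : V → Fin 3
  identify z with y FP.≟ z
  ... | yes _   = punchOut y≢x
  ... | no  y≢z = punchOut y≢z

  identify-fibres : ∀ {z z′} → identify z ≡ identify z′ → z ≡ z′ ⊎ (z ≡ y × z′ ≡ x) ⊎ (z ≡ x × z′ ≡ y)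
  identify-fibres {z} {z′} eq with y FP.≟ z | y FP.≟ z′
  ... | yes y≡z | yes y≡z′ = inj₁ (trans (sym y≡z) y≡z′)
  ... | yes y≡z | no y≢z′  = inj₂ (inj₁ (sym y≡z , sym (FP.punchOut-injective y≢x y≢z′ eq)))
  ... | no y≢z  | yes y≡z′ = inj₂ (inj₂ (FP.punchOut-injective y≢z y≢x eq , sym y≡z′))
  ... | no y≢z  | no y≢z′  = inj₁ (FP.punchOut-injective y≢z y≢z′ eq)

non3Colourable⇒adjacent : ∀ {w} → IsLoopless w → ¬ Colorable 3 w → ∀ {x y} → y ≢ x → 0 < w x y
non3Colourable⇒adjacent {w} (loopless , symmetric) ¬col {x} {y} y≢x with w x y in wxy≡
... | suc _ = s≤s z≤n
... | zero  = contradiction (identify y≢x , proper) ¬col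
  where
  proper : ∀ z z′ → 0 < w z z′ → identify y≢x z ≢ identify y≢x z′
  proper z z′ 0<w eq with identify-fibres y≢x eq
  ... | inj₁ refl                 = <-irrefl (sym (loopless z)) 0<w
  ... | inj₂ (inj₁ (refl , refl)) = <-irrefl (sym (trans (symmetric y x) wxy≡)) 0<w
  ... | inj₂ (inj₂ (refl , refl)) = <-irrefl (sym wxy≡) 0<w

weight-positive : ∀ {w} → IsLoopless w → ¬ Colorable 3 w → ∀ P → 1 ≤ weight w P
weight-positive loopless ¬col P =
  non3Colourable⇒adjacent loopless ¬col (λ eq → <-irrefl (sym (cong toℕ eq)) (lower<upper P))

-- Greedy edge colouring

predecessors : ∀ {k} → List (Fin (suc k)) → List (Fin k)
predecessors []            = []
predecessors (F.zero ∷ U)  = predecessors U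
predecessors (F.suc c ∷ U) = c ∷ predecessors U

∈-predecessors : ∀ {k} {c : Fin k} U → F.suc c ∈ U → c ∈ predecessors U
∈-predecessors (F.zero ∷ U)  (there c∈U) = ∈-predecessors U c∈U
∈-predecessors (F.suc c ∷ U) (here refl) = here refl
∈-predecessors (F.suc c ∷ U) (there c∈U) = there (∈-predecessors U c∈U)

length-predecessors : ∀ {k} (U : List (Fin (suc k))) → length (predecessors U) ≤ length U
length-predecessors []            = z≤n
length-predecessors (F.zero ∷ U)  = m≤n⇒m≤1+n (length-predecessors U)
length-predecessors (F.suc c ∷ U) = s≤s (length-predecessors U)

length-predecessors-< : ∀ {k} (U : List (Fin (suc k))) → F.zero ∈ U → length (predecessors U) < length U
length-predecessors-< (F.zero ∷ U)  _           = s≤s (length-predecessors U)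
length-predecessors-< (F.suc c ∷ U) (there 0∈U) = s≤s (length-predecessors-< U 0∈U)

countTrue≤length : ∀ k (S : Fin k → Bool) (U : List (Fin k)) → (∀ c → S c ≡ true → c ∈ U) → countTrue k S ≤ length U
countTrue≤length zero    S U S⊆U = z≤n
countTrue≤length (suc k) S U S⊆U with S F.zero in S0
... | true  = ≤-trans (s≤s rest) (length-predecessors-< U (S⊆U F.zero S0))
  where rest = countTrue≤length k (S ∘ F.suc) (predecessors U) λ c Sc → ∈-predecessors U (S⊆U (F.suc c) Sc)
... | false = ≤-trans rest (length-predecessors U)
  where rest = countTrue≤length k (S ∘ F.suc) (predecessors U) λ c Sc → ∈-predecessors U (S⊆U (F.suc c) Sc)

_∈?_ : ∀ {k} (c : Fin k) (U : List (Fin k)) → Dec (c ∈ U)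
c ∈? U = any? (c FP.≟_) U

fresh-colour : ∀ {k} (S : Fin k → Bool) (U : List (Fin k)) → length U < countTrue k S → ∃ λ c → S c ≡ true × c ∉ U
fresh-colour {k} S U U<S with FP.any? (λ c → (S c ≟ᵇ true) ×-dec ¬? (c ∈? U))
... | yes found = found
... | no  none  = contradiction (countTrue≤length k S U S⊆U) (<⇒≱ U<S)
  where
  S⊆U : ∀ c → S c ≡ true → c ∈ U
  S⊆U c Sc = decidable-stable (c ∈? U) λ c∉U → none (c , Sc , c∉U)

-- c₀ only colours the elements outside the list.
module Greedy {A : Set} (_≟ᴬ_ : DecidableEquality A) {k : ℕ} (S : A → Fin k → Bool) (c₀ : Fin k) where

  Fits : ℕ → List A → Set
  Fits n []       = ⊤
  Fits n (a ∷ as) = n < countTrue k (S a) × Fits (suc n) as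

  Fits-map-++ : ∀ {X : Set} (f : X → A) xs {n C} rest → (∀ x → countTrue k (S (f x)) ≡ C) →
    n + length xs ≤ C → Fits (n + length xs) rest → Fits n (map f xs ++ rest)
  Fits-map-++ f []       {n} rest _    _     fits = subst (λ m → Fits m rest) (+-identityʳ n) fits
  Fits-map-++ f (x ∷ xs) {n} rest same bound fits =
    subst (n <_) (sym (same x)) (≤-trans (s≤s (m≤m+n n (length xs))) (≤-trans (≤-reflexive (sym (+-suc n _))) bound)) ,
    Fits-map-++ f xs rest same (≤-trans (≤-reflexive (sym (+-suc n _))) bound)
      (subst (λ m → Fits m rest) (+-suc n (length xs)) fits)

  record Colouring (U : List (Fin k)) (as : List A) : Set where
    field
      colour    : A → Fin k
      allowed   : ∀ {a} → a ∈ as → S a (colour a) ≡ true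
      fresh     : ∀ {a} → a ∈ as → colour a ∉ U
      injective : ∀ {a b} → a ∈ as → b ∈ as → colour a ≡ colour b → a ≡ b

  ∈-tail : ∀ {z a : A} {as} → z ∈ a ∷ as → z ≢ a → z ∈ as
  ∈-tail (here z≡a)  z≢a = contradiction z≡a z≢a
  ∈-tail (there z∈as) _  = z∈as

  greedy : ∀ U as → Fits (length U) as → Colouring U as
  greedy U []       _             = record { colour = λ _ → c₀ ; allowed = λ () ; fresh = λ () ; injective = λ () }
  greedy U (a ∷ as) (U<Sa , fits) = record
    { colour = colour ; allowed = allowed ; fresh = fresh ; injective = injective }
    where
    c    = proj₁ (fresh-colour (S a) U U<Sa)
    Sa-c = proj₁ (proj₂ (fresh-colour (S a) U U<Sa))
    c∉U  = proj₂ (proj₂ (fresh-colour (S a) U U<Sa))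
    open Colouring (greedy (c ∷ U) as fits) renaming
      (colour to colourᵣ; allowed to allowedᵣ; fresh to freshᵣ; injective to injectiveᵣ)

    colour : A → Fin k
    colour z with z ≟ᴬ a
    ... | yes _ = c
    ... | no  _ = colourᵣ z

    colour-a : ∀ {z} → z ≡ a → colour z ≡ c
    colour-a {z} z≡a with z ≟ᴬ a
    ... | yes _   = refl
    ... | no  z≢a = contradiction z≡a z≢a

    colour-as : ∀ {z} → z ≢ a → colour z ≡ colourᵣ z
    colour-as {z} z≢a with z ≟ᴬ a
    ... | yes z≡a = contradiction z≡a z≢a
    ... | no  _   = refl

    allowed : ∀ {z} → z ∈ a ∷ as → S z (colour z) ≡ true
    allowed {z} z∈ = by-cases (z ≟ᴬ a)
      where
      by-cases : Dec (z ≡ a) → S z (colour z) ≡ true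
      by-cases (yes z≡a) = trans (cong (S z) (colour-a z≡a)) (subst (λ y → S y c ≡ true) (sym z≡a) Sa-c)
      by-cases (no z≢a)  = trans (cong (S z) (colour-as z≢a)) (allowedᵣ (∈-tail z∈ z≢a))

    fresh : ∀ {z} → z ∈ a ∷ as → colour z ∉ U
    fresh {z} z∈ = by-cases (z ≟ᴬ a)
      where
      by-cases : Dec (z ≡ a) → colour z ∉ U
      by-cases (yes z≡a) = subst (_∉ U) (sym (colour-a z≡a)) c∉U
      by-cases (no z≢a)  = subst (_∉ U) (sym (colour-as z≢a)) (freshᵣ (∈-tail z∈ z≢a) ∘ there)

    new-colour : ∀ {z z′} → z ≡ a → z′ ∈ a ∷ as → z′ ≢ a → colour z ≢ colour z′
    new-colour {z′ = z′} z≡a z′∈ z′≢a eq =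
      freshᵣ (∈-tail z′∈ z′≢a) (here (trans (sym (colour-as z′≢a)) (trans (sym eq) (colour-a z≡a))))

    injective : ∀ {z z′} → z ∈ a ∷ as → z′ ∈ a ∷ as → colour z ≡ colour z′ → z ≡ z′
    injective {z} {z′} z∈ z′∈ eq = by-cases (z ≟ᴬ a) (z′ ≟ᴬ a)
      where
      by-cases : Dec (z ≡ a) → Dec (z′ ≡ a) → z ≡ z′
      by-cases (yes z≡a) (yes z′≡a) = trans z≡a (sym z′≡a)
      by-cases (yes z≡a) (no z′≢a)  = contradiction eq (new-colour z≡a z′∈ z′≢a)
      by-cases (no z≢a)  (yes z′≡a) = contradiction (sym eq) (new-colour z′≡a z∈ z≢a)
      by-cases (no z≢a)  (no z′≢a)  = injectiveᵣ (∈-tail z∈ z≢a) (∈-tail z′∈ z′≢a)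
        (trans (sym (colour-as z≢a)) (trans eq (colour-as z′≢a)))

mult-sym : ∀ {k} {E : SimplyColored k} → IsSimplyColored E → ∀ u v → mult E u v ≡ mult E v u
mult-sym {k} {E} (_ , symmetric) u v = countTrue-cong k λ c → symmetric c u v
  where
  countTrue-cong : ∀ k {f g : Fin k → Bool} → (∀ c → f c ≡ g c) → countTrue k f ≡ countTrue k g
  countTrue-cong zero    f≗g = refl
  countTrue-cong (suc k) f≗g = cong₂ _+_ (cong (λ b → if b then 1 else 0) (f≗g F.zero)) (countTrue-cong k (f≗g ∘ F.suc))

mult≤k : ∀ {k} (E : SimplyColored k) u v → mult E u v ≤ k
mult≤k {k} E u v = ≤-trans (countTrue≤length k _ (allFin k) (λ c _ → ∈-allFin c)) (≤-reflexive (List.length-tabulate id))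

-- Multiplicity with the vertices in increasing order, the form in which the theorem states its hypotheses.
mult⁺ : ∀ {k} → SimplyColored k → V → V → ℕ
mult⁺ E u v = if toℕ u ≤ᵇ toℕ v then mult E u v else mult E v u

mult⁺≡mult : ∀ {k} {E : SimplyColored k} → IsSimplyColored E → ∀ u v → mult⁺ E u v ≡ mult E u v
mult⁺≡mult simple u v with toℕ u ≤ᵇ toℕ v
... | true  = refl
... | false = mult-sym simple v u

Cumulative : ℕ → List (ℕ × ℕ) → Set
Cumulative n []             = ⊤
Cumulative n ((d , s) ∷ ds) = n + d ≤ s × Cumulative (n + d) ds

Schedule : Set
Schedule = List Pair

-- A schedule lists every pair exactly once; stated via sorting, this is decidable.
IsSchedule : Schedule → Set
IsSchedule σ = sort σ ≡ allFin 6

schedule? : ∀ σ → Dec (IsSchedule σ)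
schedule? σ = List.≡-dec FP._≟_ (sort σ) (allFin 6)

∈-schedule : ∀ {σ} → IsSchedule σ → ∀ P → P ∈ σ
∈-schedule {σ} sorted P = ∈-resp-↭ (sort-↭ σ) (subst (P ∈_) (sym sorted) (∈-allFin P))

schedule-total : ∀ {σ} → IsSchedule σ → ∀ w → sum (map (weight w) σ) ≡ edgeCount w
schedule-total {σ} sorted w = begin
  sum (map (weight w) σ)        ≡⟨ sum-↭ (map⁺ (weight w) (↭-sym (sort-↭ σ))) ⟩
  sum (map (weight w) (sort σ)) ≡⟨ cong (sum ∘ map (weight w)) sorted ⟩
  sum (map (weight w) (allFin 6)) ≡⟨ sum-weights≡edgeCount w ⟩
  edgeCount w                   ∎
  where open ≡-Reasoning

injective? : (φ : V → V) → Dec (∀ x y → φ x ≡ φ y → x ≡ y)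
injective? φ = FP.all? λ x → FP.all? λ y → (φ x FP.≟ φ y) →-dec (x FP.≟ y)

module _ {w : Mult} where

  slotsOf : Pair → List (Slot w)
  slotsOf P = map (λ i → lower P , upper P , lower<upper P , i) (allFin (weight w P))

  slot∈slotsOf : (s : Slot w) → Σ Pair λ P → s ∈ slotsOf P
  slot∈slotsOf (x , y , x<y , i) with pairOf x<y
  ... | P , refl , refl = P , subst (λ p → (lower P , upper P , p , i) ∈ slotsOf P)
                                    (FP.<-irrelevant (lower<upper P) x<y) (∈-map⁺ _ (∈-allFin i))

  _≟ˢ_ : DecidableEquality (Slot w)
  _≟ˢ_ = Σ.≡-dec FP._≟_ (Σ.≡-dec FP._≟_ (Σ.≡-dec (λ p q → yes (FP.<-irrelevant p q)) FP._≟_))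

-- The decidable side conditions are discharged by evaluation once φ and σ are concrete.
greedy-copy : ∀ {k} {E : SimplyColored k} → IsSimplyColored E → Fin k → ∀ {w} (φ : V → V) {_ : True (injective? φ)}
  (σ : Schedule) {_ : True (schedule? σ)} →
  (sum (map (weight w) σ) ≡ edgeCount w →
     Cumulative 0 (map (λ P → weight w P , mult⁺ E (φ (lower P)) (φ (upper P))) σ)) →
  MulticoloredCopy E w
greedy-copy {k} {E} simple c₀ {w} φ {φ-injective} σ {schedule} cumulative =
  φ , (λ {x} {y} → toWitness φ-injective x y) , colour , injective′ , allowed′
  where
  S : Slot w → Fin k → Bool
  S s c = E c (φ (slotFst s)) (φ (slotSnd s))

  open Greedy _≟ˢ_ S c₀

  fits : ∀ n τ → Cumulative n (map (λ P → weight w P , mult⁺ E (φ (lower P)) (φ (upper P))) τ) →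
    Fits n (concatMap slotsOf τ)
  fits n []      _              = tt
  fits n (P ∷ τ) (bound , rest) =
    Fits-map-++ _ (allFin (weight w P)) _ (λ _ → refl)
      (subst (n + length (allFin (weight w P)) ≤_) (mult⁺≡mult simple _ _)
        (subst (λ d → n + d ≤ mult⁺ E (φ (lower P)) (φ (upper P))) (sym (List.length-tabulate id)) bound))
      (subst (λ d → Fits (n + d) _) (sym (List.length-tabulate id)) (fits (n + weight w P) τ rest))

  open Colouring (greedy [] (concatMap slotsOf σ) (fits 0 σ (cumulative (schedule-total {σ} (toWitness schedule) w))))

  covered : ∀ s → s ∈ concatMap slotsOf σ
  covered s = ∈-concat⁺′ (proj₂ (slot∈slotsOf s)) (∈-map⁺ slotsOf (∈-schedule {σ} (toWitness schedule) (proj₁ (slot∈slotsOf s))))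

  injective′ : Injective _≡_ _≡_ colour
  injective′ {s} {t} = injective (covered s) (covered t)

  allowed′ : ∀ s → S s (colour s) ≡ true
  allowed′ s = allowed (covered s)

-- Linear arithmetic

≤-by-combination : ∀ {X Y A B : ℕ} N c .{{_ : NonZero N}} → A ≤ B → N * X + B + c ≡ N * Y + A → X ≤ Y
≤-by-combination {X} {Y} {A} {B} N c A≤B eq = *-cancelˡ-≤ N (+-cancelʳ-≤ A (N * X) (N * Y)
  (≤-trans (+-monoʳ-≤ (N * X) A≤B) (≤-trans (m≤m+n (N * X + B) c) (≤-reflexive eq))))

infixl 6 _⊕_
_⊕_ : ∀ {a b c d} → a ≤ b → c ≤ d → a + c ≤ b + d
_⊕_ = +-mono-≤

infix 7 _⊛_
_⊛_ : ∀ {a b} m → a ≤ b → m * a ≤ m * b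
m ⊛ a≤b = *-monoʳ-≤ m a≤b

half-≤ : ∀ {x y} → 2 * x ≤ 2 * y + 1 → x ≤ y
half-≤ {x} {y} 2x≤2y+1 = s≤s⁻¹ (*-cancelˡ-< 2 x (suc y) (≤-trans (s≤s 2x≤2y+1) (≤-reflexive (solve (y ∷ [])))))

prefix-bound : ∀ {X Y r s h} → X + Y ≡ h → r ≤ Y → h ≤ s + r → X ≤ s
prefix-bound {X} {Y} {r} {s} X+Y≡h r≤Y h≤s+r =
  +-cancelʳ-≤ r X s (≤-trans (+-monoʳ-≤ X r≤Y) (≤-trans (≤-reflexive X+Y≡h) h≤s+r))

record HostBounds (h a b₁ b₂ c-min c-mid c-max : ℕ) : Set where
  field
    a-bound      : h ≤ a
    b₁-bound     : h ≤ 2 * b₁ + 1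
    b₂-bound     : h ≤ b₂ + 1
    c-min-pos    : 1 ≤ c-min
    c-mid-bound  : 3 * h ≤ 4 * c-mid + 3
    c-max-bound  : h ≤ c-max + 1
    c-low-bound  : 3 * h ≤ 2 * c-min + 2 * c-mid + 3
    c-mid≤c-max  : c-mid ≤ c-max

module _ {h a b₁ b₂ c-min c-mid c-max : ℕ} (G : HostBounds h a b₁ b₂ c-min c-mid c-max)
         {e₁ e₂ e₃ e₄ e₅ e₆ : ℕ} (total : sum (e₁ ∷ e₂ ∷ e₃ ∷ e₄ ∷ e₅ ∷ e₆ ∷ []) ≡ h) where
  open HostBounds G

  private
    total′ : e₁ + e₂ + e₃ + e₄ + e₅ + e₆ ≡ h
    total′ = trans (sym (sum-six e₁ e₂ e₃ e₄ e₅ e₆)) total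

  last-two : 1 ≤ e₆ → Cumulative (e₁ + e₂ + e₃ + e₄) ((e₅ , b₂) ∷ (e₆ , a) ∷ [])
  last-two 1≤e₆ = prefix-bound total′ 1≤e₆ b₂-bound , ≤-trans (≤-reflexive total′) a-bound , tt

  cumulative-via-light-pair : e₁ ≡ 1 → 2 * (e₂ + e₃) + 2 ≤ h → 1 ≤ e₅ → 1 ≤ e₆ → 6 ≤ h →
    Cumulative 0 ((e₁ , c-min) ∷ (e₂ , c-mid) ∷ (e₃ , b₁) ∷ (e₄ , c-max) ∷ (e₅ , b₂) ∷ (e₆ , a) ∷ [])
  cumulative-via-light-pair e₁≡1 light 1≤e₅ 1≤e₆ 6≤h =
    ≤-trans (≤-reflexive e₁≡1) c-min-pos ,
    ≤-by-combination 4 (4 * e₃ + 3) (2 ⊛ light ⊕ c-mid-bound ⊕ 4 ⊛ ≤-reflexive e₁≡1 ⊕ 6≤h)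
      (solve (e₁ ∷ e₂ ∷ e₃ ∷ h ∷ c-mid ∷ [])) ,
    half-≤ (≤-by-combination 1 0 (light ⊕ b₁-bound ⊕ 2 ⊛ ≤-reflexive e₁≡1) (solve (e₁ ∷ e₂ ∷ e₃ ∷ h ∷ b₁ ∷ []))) ,
    prefix-bound (trans (sym (+-assoc _ e₅ e₆)) total′) (≤-trans 1≤e₅ (m≤m+n e₅ e₆)) c-max-bound ,
    last-two 1≤e₆

  cumulative-via-roomy-mid : e₁ ≡ 1 → e₂ < b₁ → e₁ + e₂ + e₃ ≤ c-mid → 1 ≤ e₅ → 1 ≤ e₆ →
    Cumulative 0 ((e₁ , c-min) ∷ (e₂ , b₁) ∷ (e₃ , c-mid) ∷ (e₄ , c-max) ∷ (e₅ , b₂) ∷ (e₆ , a) ∷ [])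
  cumulative-via-roomy-mid e₁≡1 e₂<b₁ roomy 1≤e₅ 1≤e₆ =
    ≤-trans (≤-reflexive e₁≡1) c-min-pos ,
    subst (λ x → x + e₂ ≤ b₁) (sym e₁≡1) e₂<b₁ ,
    roomy ,
    prefix-bound (trans (sym (+-assoc _ e₅ e₆)) total′) (≤-trans 1≤e₅ (m≤m+n e₅ e₆)) c-max-bound ,
    last-two 1≤e₆

  cumulative-via-heavy-last : 4 * e₁ + e₆ + 1 ≤ h → c-mid ≤ e₆ + e₁ → 1 ≤ e₅ → e₆ < b₁ → 6 ≤ h →
    Cumulative 0 ((e₁ , c-min) ∷ (e₂ , c-mid) ∷ (e₃ , c-max) ∷ (e₄ , b₁) ∷ (e₅ , b₂) ∷ (e₆ , a) ∷ [])
  cumulative-via-heavy-last light crowded 1≤e₅ e₆<b₁ 6≤h =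
    ≤-by-combination 2 (8 * e₁ + e₆) (c-low-bound ⊕ 2 ⊛ crowded ⊕ 3 ⊛ light)
      (solve (e₁ ∷ e₆ ∷ h ∷ c-min ∷ c-mid ∷ [])) ,
    ≤-trans (≤-trans (m≤m+n _ e₃) (≤-trans (m≤m+n _ e₄) (m≤m+n _ e₅))) all-but-last ,
    ≤-trans (≤-trans (m≤m+n _ e₄) (m≤m+n _ e₅)) (≤-trans all-but-last c-mid≤c-max) ,
    ≤-by-combination 2 (e₆ + 2) (2 ⊛ ≤-reflexive total′ ⊕ 2 ⊛ 1≤e₅ ⊕ heavy ⊕ 2 ⊛ e₆<b₁)
      (solve (e₁ ∷ e₂ ∷ e₃ ∷ e₄ ∷ e₅ ∷ e₆ ∷ h ∷ b₁ ∷ [])) ,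
    last-two 1≤e₆
    where
    heavy : 2 * h ≤ 3 * e₆ + 2
    heavy = ≤-by-combination 1 0 (c-mid-bound ⊕ 4 ⊛ crowded ⊕ light) (solve (e₁ ∷ e₆ ∷ h ∷ c-mid ∷ []))
    all-but-last : e₁ + e₂ + e₃ + e₄ + e₅ ≤ c-mid
    all-but-last = ≤-by-combination 12 13 (12 ⊛ ≤-reflexive total′ ⊕ 3 ⊛ c-mid-bound ⊕ 4 ⊛ heavy ⊕ 5 ⊛ 6≤h)
      (solve (e₁ ∷ e₂ ∷ e₃ ∷ e₄ ∷ e₅ ∷ e₆ ∷ h ∷ c-mid ∷ []))
    1≤e₆ : 1 ≤ e₆
    1≤e₆ = ≤-by-combination 3 7 (heavy ⊕ 2 ⊛ 6≤h) (solve (e₆ ∷ h ∷ []))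

module _ {w₁₂ w₁₃ w₁₄ w₂₃ w₂₄ w₃₄ : ℕ} (w₁₂≡1 : w₁₂ ≡ 1) where

  light-half : 1 ≤ w₃₄ → ∀ {X Y} → X ≤ Y → X + Y ≡ w₁₃ + w₁₄ + w₂₃ + w₂₄ →
    2 * X + 2 ≤ w₁₂ + w₁₃ + w₁₄ + w₂₃ + w₂₄ + w₃₄
  light-half 1≤w₃₄ {X} {Y} X≤Y X+Y≡ =
    ≤-by-combination 1 0 (X≤Y ⊕ ≤-reflexive X+Y≡ ⊕ ≤-reflexive (sym w₁₂≡1) ⊕ 1≤w₃₄)
      (solve (X ∷ Y ∷ w₁₂ ∷ w₁₃ ∷ w₁₄ ∷ w₂₃ ∷ w₂₄ ∷ w₃₄ ∷ []))

  lighter-half : 1 ≤ w₃₄ → ∀ {X Y} → X + Y ≡ w₁₃ + w₁₄ + w₂₃ + w₂₄ →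
    (2 * X + 2 ≤ w₁₂ + w₁₃ + w₁₄ + w₂₃ + w₂₄ + w₃₄) ⊎ (2 * Y + 2 ≤ w₁₂ + w₁₃ + w₁₄ + w₂₃ + w₂₄ + w₃₄)
  lighter-half 1≤w₃₄ {X} {Y} X+Y≡ with ≤-total X Y
  ... | inj₁ X≤Y = inj₁ (light-half 1≤w₃₄ X≤Y X+Y≡)
  ... | inj₂ Y≤X = inj₂ (light-half 1≤w₃₄ Y≤X (trans (+-comm Y X) X+Y≡))

  lightest-bound : ∀ {m} → m ≤ w₁₃ → m ≤ w₁₄ → m ≤ w₂₃ → m ≤ w₂₄ →
    4 * m + w₃₄ + 1 ≤ w₁₂ + w₁₃ + w₁₄ + w₂₃ + w₂₄ + w₃₄
  lightest-bound {m} m≤₁₃ m≤₁₄ m≤₂₃ m≤₂₄ =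
    ≤-by-combination 1 0 (m≤₁₃ ⊕ m≤₁₄ ⊕ m≤₂₃ ⊕ m≤₂₄ ⊕ ≤-reflexive (sym w₁₂≡1))
      (solve (m ∷ w₁₂ ∷ w₁₃ ∷ w₁₄ ∷ w₂₃ ∷ w₂₄ ∷ w₃₄ ∷ []))

crowded-mid : ∀ {w₁₂ x y c} → w₁₂ ≡ 1 → ¬ (w₁₂ + x + y ≤ c) → c ≤ x + y
crowded-mid {x = x} {y} w₁₂≡1 ¬fits = s≤s⁻¹ (subst (λ t → _ < t + x + y) w₁₂≡1 (≰⇒> ¬fits))

two-matchings : ∀ w₁₃ w₁₄ w₂₃ w₂₄ → w₁₃ + w₂₄ + (w₁₄ + w₂₃) ≡ w₁₃ + w₁₄ + w₂₃ + w₂₄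
two-matchings = solve-∀

two-stars : ∀ w₁₃ w₁₄ w₂₃ w₂₄ → w₁₃ + w₂₃ + (w₁₄ + w₂₄) ≡ w₁₃ + w₁₄ + w₂₃ + w₂₄
two-stars = solve-∀

min3≤ : ∀ a b c → min3 a b c ≤ a × min3 a b c ≤ b × min3 a b c ≤ c
min3≤ a b c = ≤-trans (m⊓n≤m (a ⊓ b) c) (m⊓n≤m a b) , ≤-trans (m⊓n≤m (a ⊓ b) c) (m⊓n≤n a b) , m⊓n≤n (a ⊓ b) c

mid3≤ : ∀ a b c {y} → (a ≤ y × b ≤ y) ⊎ (a ≤ y × c ≤ y) ⊎ (b ≤ y × c ≤ y) → mid3 a b c ≤ y
mid3≤ a b c (inj₁ (a≤y , b≤y))        = ⊔-lub (≤-trans (m⊓n≤m a b) a≤y) (≤-trans (m⊓n≤m (a ⊔ b) c) (⊔-lub a≤y b≤y))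
mid3≤ a b c (inj₂ (inj₁ (a≤y , c≤y))) = ⊔-lub (≤-trans (m⊓n≤m a b) a≤y) (≤-trans (m⊓n≤n (a ⊔ b) c) c≤y)
mid3≤ a b c (inj₂ (inj₂ (b≤y , c≤y))) = ⊔-lub (≤-trans (m⊓n≤n a b) b≤y) (≤-trans (m⊓n≤n (a ⊔ b) c) c≤y)

max3≤ : ∀ {a b c z} → a ≤ z → b ≤ z → c ≤ z → max3 a b c ≤ z
max3≤ a≤z b≤z c≤z = ⊔-lub (⊔-lub a≤z b≤z) c≤z

-- t stands for 3 * h ∸ 3, which the ring solver cannot see through.
low-pair-bound : ∀ {h t k x y z} → 3 * h ≤ 3 + t → t ≤ x + y + z → 2 * k ≤ x + y + z → z ≤ k → 3 * h ≤ 2 * x + 2 * y + 3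
low-pair-bound {h} {t} {k} {x} {y} {z} 3h≤ t≤ 2k≤ z≤k =
  ≤-by-combination 1 0 (3h≤ ⊕ t≤ ⊕ 2k≤ ⊕ 2 ⊛ z≤k) (solve (h ∷ t ∷ k ∷ x ∷ y ∷ z ∷ []))

data StarOrder (h a b₁ b₂ c₁ c₂ c₃ : ℕ) : Set where
  order-123 : HostBounds h a b₁ b₂ c₁ c₂ c₃ → StarOrder h a b₁ b₂ c₁ c₂ c₃
  order-132 : HostBounds h a b₁ b₂ c₁ c₃ c₂ → StarOrder h a b₁ b₂ c₁ c₂ c₃
  order-213 : HostBounds h a b₁ b₂ c₂ c₁ c₃ → StarOrder h a b₁ b₂ c₁ c₂ c₃
  order-231 : HostBounds h a b₁ b₂ c₂ c₃ c₁ → StarOrder h a b₁ b₂ c₁ c₂ c₃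
  order-312 : HostBounds h a b₁ b₂ c₃ c₁ c₂ → StarOrder h a b₁ b₂ c₁ c₂ c₃
  order-321 : HostBounds h a b₁ b₂ c₃ c₂ c₁ → StarOrder h a b₁ b₂ c₁ c₂ c₃

module _ {h k a b₁ b₂ c₁ c₂ c₃ : ℕ}
  (a-bound : h ≤ a) (b₁-bound : h ≤ 2 * b₁ + 1) (b₂-bound : h ≤ b₂ + 1)
  (sum-bound : (3 * h ∸ 3) ⊔ (2 * k) ≤ c₁ + c₂ + c₃) (min-bound : 1 ≤ min3 c₁ c₂ c₃)
  (mid-bound : 3 * h ∸ 3 ≤ 4 * mid3 c₁ c₂ c₃) (max-bound : h ≤ max3 c₁ c₂ c₃ + 1) where

  host-bounds : ∀ {x y z} → min3 c₁ c₂ c₃ ≤ x → mid3 c₁ c₂ c₃ ≤ y → max3 c₁ c₂ c₃ ≤ z → y ≤ z → z ≤ k →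
    x + y + z ≡ c₁ + c₂ + c₃ → HostBounds h a b₁ b₂ x y z
  host-bounds {x} {y} {z} min≤x mid≤y max≤z y≤z z≤k sum≡ = record
    { a-bound     = a-bound
    ; b₁-bound    = b₁-bound
    ; b₂-bound    = b₂-bound
    ; c-min-pos   = ≤-trans min-bound min≤x
    ; c-mid-bound = ≤-trans (m≤n+m∸n (3 * h) 3)
                      (≤-trans (+-monoʳ-≤ 3 (≤-trans mid-bound (4 ⊛ mid≤y))) (≤-reflexive (+-comm 3 (4 * y))))
    ; c-max-bound = ≤-trans max-bound (+-monoˡ-≤ 1 max≤z)
    ; c-low-bound = low-pair-bound {h} {3 * h ∸ 3} {k} {x} {y} {z} (m≤n+m∸n (3 * h) 3)
                      (≤-trans (m⊔n≤o⇒m≤o _ _ sum-bound) (≤-reflexive (sym sum≡)))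
                      (≤-trans (m⊔n≤o⇒n≤o _ _ sum-bound) (≤-reflexive (sym sum≡))) z≤k
    ; c-mid≤c-max = y≤z
    }

  private
    min≤₁ = proj₁ (min3≤ c₁ c₂ c₃)
    min≤₂ = proj₁ (proj₂ (min3≤ c₁ c₂ c₃))
    min≤₃ = proj₂ (proj₂ (min3≤ c₁ c₂ c₃))

  star-order : c₁ ≤ k → c₂ ≤ k → c₃ ≤ k → StarOrder h a b₁ b₂ c₁ c₂ c₃
  star-order c₁≤k c₂≤k c₃≤k with ≤-total c₁ c₂ | ≤-total c₂ c₃ | ≤-total c₁ c₃
  ... | inj₁ 1≤2 | inj₁ 2≤3 | _       = order-123 (host-bounds min≤₁ (mid3≤ c₁ c₂ c₃ (inj₁ (1≤2 , ≤-refl)))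
    (max3≤ (≤-trans 1≤2 2≤3) 2≤3 ≤-refl) 2≤3 c₃≤k refl)
  ... | inj₁ 1≤2 | inj₂ 3≤2 | inj₁ 1≤3 = order-132 (host-bounds min≤₁ (mid3≤ c₁ c₂ c₃ (inj₂ (inj₁ (1≤3 , ≤-refl))))
    (max3≤ 1≤2 ≤-refl 3≤2) 3≤2 c₂≤k (solve (c₁ ∷ c₂ ∷ c₃ ∷ [])))
  ... | inj₁ 1≤2 | inj₂ 3≤2 | inj₂ 3≤1 = order-312 (host-bounds min≤₃ (mid3≤ c₁ c₂ c₃ (inj₂ (inj₁ (≤-refl , 3≤1))))
    (max3≤ 1≤2 ≤-refl 3≤2) 1≤2 c₂≤k (solve (c₁ ∷ c₂ ∷ c₃ ∷ [])))
  ... | inj₂ 2≤1 | inj₁ 2≤3 | inj₁ 1≤3 = order-213 (host-bounds min≤₂ (mid3≤ c₁ c₂ c₃ (inj₁ (≤-refl , 2≤1)))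
    (max3≤ 1≤3 2≤3 ≤-refl) 1≤3 c₃≤k (solve (c₁ ∷ c₂ ∷ c₃ ∷ [])))
  ... | inj₂ 2≤1 | inj₁ 2≤3 | inj₂ 3≤1 = order-231 (host-bounds min≤₂ (mid3≤ c₁ c₂ c₃ (inj₂ (inj₂ (2≤3 , ≤-refl))))
    (max3≤ ≤-refl 2≤1 3≤1) 3≤1 c₁≤k (solve (c₁ ∷ c₂ ∷ c₃ ∷ [])))
  ... | inj₂ 2≤1 | inj₂ 3≤2 | _       = order-321 (host-bounds min≤₃ (mid3≤ c₁ c₂ c₃ (inj₂ (inj₂ (≤-refl , 3≤2))))
    (max3≤ ≤-refl 2≤1 (≤-trans 3≤2 2≤1)) 2≤1 c₁≤k (solve (c₁ ∷ c₂ ∷ c₃ ∷ [])))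

data Lightest (a b c d : ℕ) : Set where
  first  : a ≤ b → a ≤ c → a ≤ d → Lightest a b c d
  second : b ≤ a → b ≤ c → b ≤ d → Lightest a b c d
  third  : c ≤ a → c ≤ b → c ≤ d → Lightest a b c d
  fourth : d ≤ a → d ≤ b → d ≤ c → Lightest a b c d

lightest : ∀ a b c d → Lightest a b c d
lightest a b c d with ≤-total a b | ≤-total c d
... | inj₁ a≤b | inj₁ c≤d with ≤-total a c
...   | inj₁ a≤c = first a≤b a≤c (≤-trans a≤c c≤d)
...   | inj₂ c≤a = third c≤a (≤-trans c≤a a≤b) c≤d
lightest a b c d | inj₁ a≤b | inj₂ d≤c with ≤-total a d
...   | inj₁ a≤d = first a≤b (≤-trans a≤d d≤c) a≤d
...   | inj₂ d≤a = fourth d≤a (≤-trans d≤a a≤b) d≤c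
lightest a b c d | inj₂ b≤a | inj₁ c≤d with ≤-total b c
...   | inj₁ b≤c = second b≤a b≤c (≤-trans b≤c c≤d)
...   | inj₂ c≤b = third (≤-trans c≤b b≤a) c≤b c≤d
lightest a b c d | inj₂ b≤a | inj₂ d≤c with ≤-total b d
...   | inj₁ b≤d = second b≤a (≤-trans b≤d d≤c) b≤d
...   | inj₂ d≤b = fourth (≤-trans d≤b b≤a) d≤b d≤c

⟨_,_,_,_⟩ : V → V → V → V → V → V
⟨ a , b , c , d ⟩ F.zero                         = a
⟨ a , b , c , d ⟩ (F.suc F.zero)                 = b
⟨ a , b , c , d ⟩ (F.suc (F.suc F.zero))         = c
⟨ a , b , c , d ⟩ (F.suc (F.suc (F.suc F.zero))) = d

-- The six orders of the pairs at v₄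

module Cases {k} {E : SimplyColored k} (simple : IsSimplyColored E) (c₀ : Fin k)
  {w : Mult} (w₁₂≡1 : w vtx1 vtx2 ≡ 1) (positive : ∀ P → 1 ≤ weight w P) (6≤h : 6 ≤ edgeCount w)
  (x₃x₄-light : w vtx3 vtx4 < mult E vtx1 vtx3) where

  private
    h = edgeCount w
    w₁₂ = w vtx1 vtx2
    w₁₃ = w vtx1 vtx3
    w₁₄ = w vtx1 vtx4
    w₂₃ = w vtx2 vtx3
    w₂₄ = w vtx2 vtx4
    w₃₄ = w vtx3 vtx4
    c₁ = mult E vtx1 vtx4
    c₂ = mult E vtx2 vtx4
    c₃ = mult E vtx3 vtx4

  Host : ℕ → ℕ → ℕ → Set
  Host = HostBounds h (mult E vtx1 vtx2) (mult E vtx1 vtx3) (mult E vtx2 vtx3)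

  lighter : ∀ X Y → X + Y ≡ w₁₃ + w₁₄ + w₂₃ + w₂₄ → (2 * X + 2 ≤ h) ⊎ (2 * Y + 2 ≤ h)
  lighter X Y X+Y≡ = lighter-half w₁₂≡1 (positive p₃₄) {X} {Y} X+Y≡

  stars-123 : Host c₁ c₂ c₃ → MulticoloredCopy E w
  stars-123 G with lighter (w₁₃ + w₂₄) (w₁₄ + w₂₃) (two-matchings w₁₃ w₁₄ w₂₃ w₂₄)
  ... | inj₁ light = greedy-copy simple c₀ ⟨ vtx4 , vtx1 , vtx2 , vtx3 ⟩ (p₁₂ ∷ p₁₃ ∷ p₂₄ ∷ p₁₄ ∷ p₃₄ ∷ p₂₃ ∷ [])
    λ total → cumulative-via-light-pair G total w₁₂≡1 light (positive p₃₄) (positive p₂₃) 6≤h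
  ... | inj₂ light = greedy-copy simple c₀ ⟨ vtx4 , vtx1 , vtx3 , vtx2 ⟩ (p₁₂ ∷ p₁₄ ∷ p₂₃ ∷ p₁₃ ∷ p₃₄ ∷ p₂₄ ∷ [])
    λ total → cumulative-via-light-pair G total w₁₂≡1 light (positive p₃₄) (positive p₂₄) 6≤h

  stars-132 : Host c₁ c₃ c₂ → MulticoloredCopy E w
  stars-132 G with lighter (w₁₃ + w₂₃) (w₁₄ + w₂₄) (two-stars w₁₃ w₁₄ w₂₃ w₂₄)
  ... | inj₁ light = greedy-copy simple c₀ ⟨ vtx4 , vtx1 , vtx3 , vtx2 ⟩ (p₁₂ ∷ p₁₃ ∷ p₂₃ ∷ p₁₄ ∷ p₃₄ ∷ p₂₄ ∷ [])
    λ total → cumulative-via-light-pair G total w₁₂≡1 light (positive p₃₄) (positive p₂₄) 6≤h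
  ... | inj₂ light = greedy-copy simple c₀ ⟨ vtx4 , vtx1 , vtx2 , vtx3 ⟩ (p₁₂ ∷ p₁₄ ∷ p₂₄ ∷ p₁₃ ∷ p₃₄ ∷ p₂₃ ∷ [])
    λ total → cumulative-via-light-pair G total w₁₂≡1 light (positive p₃₄) (positive p₂₃) 6≤h

  stars-312 : Host c₃ c₁ c₂ → MulticoloredCopy E w
  stars-312 G with lighter (w₁₃ + w₂₃) (w₁₄ + w₂₄) (two-stars w₁₃ w₁₄ w₂₃ w₂₄)
  ... | inj₁ light = greedy-copy simple c₀ ⟨ vtx4 , vtx3 , vtx1 , vtx2 ⟩ (p₁₂ ∷ p₁₃ ∷ p₂₃ ∷ p₁₄ ∷ p₂₄ ∷ p₃₄ ∷ [])
    λ total → cumulative-via-light-pair G total w₁₂≡1 light (positive p₂₄) (positive p₃₄) 6≤h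
  ... | inj₂ light = greedy-copy simple c₀ ⟨ vtx4 , vtx3 , vtx2 , vtx1 ⟩ (p₁₂ ∷ p₁₄ ∷ p₂₄ ∷ p₁₃ ∷ p₂₃ ∷ p₃₄ ∷ [])
    λ total → cumulative-via-light-pair G total w₁₂≡1 light (positive p₂₃) (positive p₃₄) 6≤h

  stars-321 : Host c₃ c₂ c₁ → MulticoloredCopy E w
  stars-321 G with lighter (w₁₃ + w₂₄) (w₁₄ + w₂₃) (two-matchings w₁₃ w₁₄ w₂₃ w₂₄)
  ... | inj₁ light = greedy-copy simple c₀ ⟨ vtx4 , vtx3 , vtx2 , vtx1 ⟩ (p₁₂ ∷ p₁₃ ∷ p₂₄ ∷ p₁₄ ∷ p₂₃ ∷ p₃₄ ∷ [])
    λ total → cumulative-via-light-pair G total w₁₂≡1 light (positive p₂₃) (positive p₃₄) 6≤h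
  ... | inj₂ light = greedy-copy simple c₀ ⟨ vtx4 , vtx3 , vtx1 , vtx2 ⟩ (p₁₂ ∷ p₁₄ ∷ p₂₃ ∷ p₁₃ ∷ p₂₄ ∷ p₃₄ ∷ [])
    λ total → cumulative-via-light-pair G total w₁₂≡1 light (positive p₂₄) (positive p₃₄) 6≤h

  stars-231 : Host c₂ c₃ c₁ → MulticoloredCopy E w
  stars-231 G with lightest w₁₃ w₁₄ w₂₃ w₂₄
  ... | first ≤₁₄ ≤₂₃ ≤₂₄ with w₁₂ + w₃₄ + w₁₃ ≤? c₃
  ...   | yes roomy  = greedy-copy simple c₀ ⟨ vtx4 , vtx2 , vtx3 , vtx1 ⟩ (p₁₂ ∷ p₃₄ ∷ p₁₃ ∷ p₁₄ ∷ p₂₃ ∷ p₂₄ ∷ [])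
    λ total → cumulative-via-roomy-mid G total w₁₂≡1 x₃x₄-light roomy (positive p₂₃) (positive p₂₄)
  ...   | no crowded = greedy-copy simple c₀ ⟨ vtx4 , vtx3 , vtx2 , vtx1 ⟩ (p₁₃ ∷ p₁₂ ∷ p₁₄ ∷ p₂₄ ∷ p₂₃ ∷ p₃₄ ∷ [])
    λ total → cumulative-via-heavy-last G total (lightest-bound w₁₂≡1 ≤-refl ≤₁₄ ≤₂₃ ≤₂₄)
                (crowded-mid w₁₂≡1 crowded) (positive p₂₃) x₃x₄-light 6≤h
  stars-231 G | second ≤₁₃ ≤₂₃ ≤₂₄ with w₁₂ + w₃₄ + w₁₄ ≤? c₃
  ...   | yes roomy  = greedy-copy simple c₀ ⟨ vtx4 , vtx2 , vtx1 , vtx3 ⟩ (p₁₂ ∷ p₃₄ ∷ p₁₄ ∷ p₁₃ ∷ p₂₄ ∷ p₂₃ ∷ [])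
    λ total → cumulative-via-roomy-mid G total w₁₂≡1 x₃x₄-light roomy (positive p₂₄) (positive p₂₃)
  ...   | no crowded = greedy-copy simple c₀ ⟨ vtx4 , vtx3 , vtx1 , vtx2 ⟩ (p₁₄ ∷ p₁₂ ∷ p₁₃ ∷ p₂₃ ∷ p₂₄ ∷ p₃₄ ∷ [])
    λ total → cumulative-via-heavy-last G total (lightest-bound w₁₂≡1 ≤₁₃ ≤-refl ≤₂₃ ≤₂₄)
                (crowded-mid w₁₂≡1 crowded) (positive p₂₄) x₃x₄-light 6≤h
  stars-231 G | third ≤₁₃ ≤₁₄ ≤₂₄ with w₁₂ + w₃₄ + w₂₃ ≤? c₃
  ...   | yes roomy  = greedy-copy simple c₀ ⟨ vtx2 , vtx4 , vtx3 , vtx1 ⟩ (p₁₂ ∷ p₃₄ ∷ p₂₃ ∷ p₂₄ ∷ p₁₃ ∷ p₁₄ ∷ [])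
    λ total → cumulative-via-roomy-mid G total w₁₂≡1 x₃x₄-light roomy (positive p₁₃) (positive p₁₄)
  ...   | no crowded = greedy-copy simple c₀ ⟨ vtx3 , vtx4 , vtx2 , vtx1 ⟩ (p₂₃ ∷ p₁₂ ∷ p₂₄ ∷ p₁₄ ∷ p₁₃ ∷ p₃₄ ∷ [])
    λ total → cumulative-via-heavy-last G total (lightest-bound w₁₂≡1 ≤₁₃ ≤₁₄ ≤-refl ≤₂₄)
                (crowded-mid w₁₂≡1 crowded) (positive p₁₃) x₃x₄-light 6≤h
  stars-231 G | fourth ≤₁₃ ≤₁₄ ≤₂₃ with w₁₂ + w₃₄ + w₂₄ ≤? c₃
  ...   | yes roomy  = greedy-copy simple c₀ ⟨ vtx2 , vtx4 , vtx1 , vtx3 ⟩ (p₁₂ ∷ p₃₄ ∷ p₂₄ ∷ p₂₃ ∷ p₁₄ ∷ p₁₃ ∷ [])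
    λ total → cumulative-via-roomy-mid G total w₁₂≡1 x₃x₄-light roomy (positive p₁₄) (positive p₁₃)
  ...   | no crowded = greedy-copy simple c₀ ⟨ vtx3 , vtx4 , vtx1 , vtx2 ⟩ (p₂₄ ∷ p₁₂ ∷ p₂₃ ∷ p₁₃ ∷ p₁₄ ∷ p₃₄ ∷ [])
    λ total → cumulative-via-heavy-last G total (lightest-bound w₁₂≡1 ≤₁₃ ≤₁₄ ≤₂₃ ≤-refl)
                (crowded-mid w₁₂≡1 crowded) (positive p₁₄) x₃x₄-light 6≤h

  stars-213 : Host c₂ c₁ c₃ → MulticoloredCopy E w
  stars-213 G with lightest w₁₃ w₁₄ w₂₃ w₂₄
  ... | first ≤₁₄ ≤₂₃ ≤₂₄ with w₁₂ + w₃₄ + w₁₃ ≤? c₁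
  ...   | yes roomy  = greedy-copy simple c₀ ⟨ vtx4 , vtx2 , vtx1 , vtx3 ⟩ (p₁₂ ∷ p₃₄ ∷ p₁₃ ∷ p₁₄ ∷ p₂₄ ∷ p₂₃ ∷ [])
    λ total → cumulative-via-roomy-mid G total w₁₂≡1 x₃x₄-light roomy (positive p₂₄) (positive p₂₃)
  ...   | no crowded = greedy-copy simple c₀ ⟨ vtx4 , vtx3 , vtx2 , vtx1 ⟩ (p₁₃ ∷ p₁₄ ∷ p₁₂ ∷ p₂₄ ∷ p₂₃ ∷ p₃₄ ∷ [])
    λ total → cumulative-via-heavy-last G total (lightest-bound w₁₂≡1 ≤-refl ≤₁₄ ≤₂₃ ≤₂₄)
                (crowded-mid w₁₂≡1 crowded) (positive p₂₃) x₃x₄-light 6≤h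
  stars-213 G | second ≤₁₃ ≤₂₃ ≤₂₄ with w₁₂ + w₃₄ + w₁₄ ≤? c₁
  ...   | yes roomy  = greedy-copy simple c₀ ⟨ vtx4 , vtx2 , vtx3 , vtx1 ⟩ (p₁₂ ∷ p₃₄ ∷ p₁₄ ∷ p₁₃ ∷ p₂₃ ∷ p₂₄ ∷ [])
    λ total → cumulative-via-roomy-mid G total w₁₂≡1 x₃x₄-light roomy (positive p₂₃) (positive p₂₄)
  ...   | no crowded = greedy-copy simple c₀ ⟨ vtx4 , vtx3 , vtx1 , vtx2 ⟩ (p₁₄ ∷ p₁₃ ∷ p₁₂ ∷ p₂₃ ∷ p₂₄ ∷ p₃₄ ∷ [])
    λ total → cumulative-via-heavy-last G total (lightest-bound w₁₂≡1 ≤₁₃ ≤-refl ≤₂₃ ≤₂₄)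
                (crowded-mid w₁₂≡1 crowded) (positive p₂₄) x₃x₄-light 6≤h
  stars-213 G | third ≤₁₃ ≤₁₄ ≤₂₄ with w₁₂ + w₃₄ + w₂₃ ≤? c₁
  ...   | yes roomy  = greedy-copy simple c₀ ⟨ vtx2 , vtx4 , vtx1 , vtx3 ⟩ (p₁₂ ∷ p₃₄ ∷ p₂₃ ∷ p₂₄ ∷ p₁₄ ∷ p₁₃ ∷ [])
    λ total → cumulative-via-roomy-mid G total w₁₂≡1 x₃x₄-light roomy (positive p₁₄) (positive p₁₃)
  ...   | no crowded = greedy-copy simple c₀ ⟨ vtx3 , vtx4 , vtx2 , vtx1 ⟩ (p₂₃ ∷ p₂₄ ∷ p₁₂ ∷ p₁₄ ∷ p₁₃ ∷ p₃₄ ∷ [])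
    λ total → cumulative-via-heavy-last G total (lightest-bound w₁₂≡1 ≤₁₃ ≤₁₄ ≤-refl ≤₂₄)
                (crowded-mid w₁₂≡1 crowded) (positive p₁₃) x₃x₄-light 6≤h
  stars-213 G | fourth ≤₁₃ ≤₁₄ ≤₂₃ with w₁₂ + w₃₄ + w₂₄ ≤? c₁
  ...   | yes roomy  = greedy-copy simple c₀ ⟨ vtx2 , vtx4 , vtx3 , vtx1 ⟩ (p₁₂ ∷ p₃₄ ∷ p₂₄ ∷ p₂₃ ∷ p₁₃ ∷ p₁₄ ∷ [])
    λ total → cumulative-via-roomy-mid G total w₁₂≡1 x₃x₄-light roomy (positive p₁₃) (positive p₁₄)
  ...   | no crowded = greedy-copy simple c₀ ⟨ vtx3 , vtx4 , vtx1 , vtx2 ⟩ (p₂₄ ∷ p₂₃ ∷ p₁₂ ∷ p₁₃ ∷ p₁₄ ∷ p₃₄ ∷ [])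
    λ total → cumulative-via-heavy-last G total (lightest-bound w₁₂≡1 ≤₁₃ ≤₁₄ ≤₂₃ ≤-refl)
                (crowded-mid w₁₂≡1 crowded) (positive p₁₄) x₃x₄-light 6≤h

lemma4p2 : (wH : Mult) → IsLoopless wH → FourColorCritical wH →
    wH vtx1 vtx2 ≡ 1 →
    (k : ℕ) → edgeCount wH ≤ k →
    (E : SimplyColored k) → IsSimplyColored E →
    edgeCount wH ≤ mult E vtx1 vtx2 →
    edgeCount wH ≤ 2 * mult E vtx1 vtx3 + 1 →
    edgeCount wH ≤ mult E vtx2 vtx3 + 1 →
    (3 * edgeCount wH ∸ 3) ⊔ (2 * k) ≤ mult E vtx1 vtx4 + mult E vtx2 vtx4 + mult E vtx3 vtx4 →
    1 ≤ min3 (mult E vtx1 vtx4) (mult E vtx2 vtx4) (mult E vtx3 vtx4) →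
    3 * edgeCount wH ∸ 3 ≤ 4 * mid3 (mult E vtx1 vtx4) (mult E vtx2 vtx4) (mult E vtx3 vtx4) →
    edgeCount wH ≤ max3 (mult E vtx1 vtx4) (mult E vtx2 vtx4) (mult E vtx3 vtx4) + 1 →
    wH vtx3 vtx4 < mult E vtx1 vtx3 →
    MulticoloredCopy E wH
lemma4p2 wH loopless ((_ , ¬3-colourable) , _) w₁₂≡1 k h≤k E simple a-bound b₁-bound b₂-bound
         sum-bound min-bound mid-bound max-bound x₃x₄-light =
  copy (star-order a-bound b₁-bound b₂-bound sum-bound min-bound mid-bound max-bound
                   (mult≤k E vtx1 vtx4) (mult≤k E vtx2 vtx4) (mult≤k E vtx3 vtx4))
  where
  positive : ∀ P → 1 ≤ weight wH P
  positive = weight-positive loopless ¬3-colourable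

  6≤h : 6 ≤ edgeCount wH
  6≤h = positive p₁₂ ⊕ positive p₁₃ ⊕ positive p₁₄ ⊕ positive p₂₃ ⊕ positive p₂₄ ⊕ positive p₃₄

  c₀ : Fin k
  c₀ = F.fromℕ< (≤-trans (s≤s z≤n) (≤-trans 6≤h h≤k))

  open Cases simple c₀ {wH} w₁₂≡1 positive 6≤h x₃x₄-light

  copy : StarOrder _ _ _ _ _ _ _ → MulticoloredCopy E wH
  copy (order-123 G) = stars-123 G
  copy (order-132 G) = stars-132 G
  copy (order-213 G) = stars-213 G
  copy (order-231 G) = stars-231 G
  copy (order-312 G) = stars-312 G
  copy (order-321 G) = stars-321 G
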